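{- For any integer partition $\lambda$, there exists a $\mathsf{TOTO}$ sentence $\phi_\lambda$ such that for every permutation $\sigma$, $\sigma\models\phi_\lambda$ if and only if $\sigma$ has cycle-type $\lambda$.
   Context: A permutation $\sigma$ of size $n$ is identified with the finite structure whose domain is $A^\sigma=\{(i,\sigma(i)) : 1\le i\le n\}$, with position order $<_P$ (comparing first coordinates) and value order $<_V$ (comparing second coordinates); $\mathsf{TOTO}$ is first-order logic (with equality) over the signature of two binary relation symbols $<_P,<_V$. The cycle-type of $\sigma$ is the integer partition given by the multiset of lengths of the cycles of $\sigma$ viewed as a bijection of $\{1,\dots,n\}$ (fixed points being cycles of length $1$). -}

module Defs where

open import Data.Nat using (ℕ; zero; suc; _≥_; _<_)
open import Data.Fin using (Fin; toℕ) renaming (_<_ to _<ᶠ_; _≤?_ to _≤ᶠ?_)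
open import Data.Fin.Properties using (_≟_)
open import Data.Fin.Permutation using (Permutation′; _⟨$⟩ʳ_)
open import Data.List using (List; []; _∷_; map; filter; length; deduplicate; upTo; allFin)
open import Data.List.Relation.Unary.All using (All; all?)
open import Data.List.Relation.Unary.Linked using (Linked)
open import Data.List.Relation.Binary.Permutation.Propositional using (_↭_)
open import Data.Product using (Σ; _×_)
open import Data.Sum using (_⊎_)
open import Data.Empty using (⊥)
open import Data.Unit using (⊤)
open import Relation.Binary.PropositionalEquality using (_≡_)
open import Relation.Nullary using (¬_)

-- Permutations of size n: bijections of Fin n (Fin n plays {1,…,n}).
-- The structure of σ has domain the points (i, σ(i)), which we index by
-- i : Fin n; i <_P j iff i < j, and i <_V j iff σ(i) < σ(j).

Perm : ℕ → Set
Perm = Permutation′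

-- First-order logic with equality over the signature {<_P , <_V}.
-- Formula k = formulas with free variables among k de Bruijn-style
-- variables (Fin k); Sentence = Formula 0.

data Formula (k : ℕ) : Set where
  _<P_ : Fin k → Fin k → Formula k
  _<V_ : Fin k → Fin k → Formula k
  _≐_  : Fin k → Fin k → Formula k
  ⊤'   : Formula k
  ⊥'   : Formula k
  ¬'_  : Formula k → Formula k
  _∧'_ : Formula k → Formula k → Formula k
  _∨'_ : Formula k → Formula k → Formula k
  _⇒'_ : Formula k → Formula k → Formula k
  ∃'   : Formula (suc k) → Formula k
  ∀'   : Formula (suc k) → Formula k

Sentence : Set
Sentence = Formula 0

extend : ∀ {k n} → (Fin k → Fin n) → Fin n → Fin (suc k) → Fin n
extend ρ a Fin.zero    = a
extend ρ a (Fin.suc i) = ρ i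

Sat : ∀ {n k} → Perm n → Formula k → (Fin k → Fin n) → Set
Sat σ (x <P y) ρ = ρ x <ᶠ ρ y
Sat σ (x <V y) ρ = (σ ⟨$⟩ʳ ρ x) <ᶠ (σ ⟨$⟩ʳ ρ y)
Sat σ (x ≐ y)  ρ = ρ x ≡ ρ y
Sat σ ⊤'       ρ = ⊤
Sat σ ⊥'       ρ = ⊥
Sat σ (¬' φ)   ρ = ¬ Sat σ φ ρ
Sat σ (φ ∧' ψ) ρ = Sat σ φ ρ × Sat σ ψ ρ
Sat σ (φ ∨' ψ) ρ = Sat σ φ ρ ⊎ Sat σ ψ ρ
Sat σ (φ ⇒' ψ) ρ = Sat σ φ ρ → Sat σ ψ ρ
Sat σ (∃' φ)   ρ = Σ (Fin _) λ a → Sat σ φ (extend ρ a)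
Sat σ (∀' φ)   ρ = (a : Fin _) → Sat σ φ (extend ρ a)

_⊨_ : ∀ {n} → Perm n → Sentence → Set
σ ⊨ φ = Sat σ φ (λ ())

record Partition : Set where
  field
    parts    : List ℕ
    positive : All (λ m → 0 < m) parts
    nonincr  : Linked _≥_ parts

iter : ∀ {n} → Perm n → ℕ → Fin n → Fin n
iter σ zero    i = i
iter σ (suc k) i = σ ⟨$⟩ʳ iter σ k i

-- the elements σ^0(i), …, σ^(n-1)(i): exactly the cycle of σ through i
-- (listed with possible repetitions)
orbitList : ∀ {n} → Perm n → Fin n → List (Fin n)
orbitList {n} σ i = map (λ k → iter σ k i) (upTo n)

cycleLength : ∀ {n} → Perm n → Fin n → ℕ
cycleLength σ i = length (deduplicate _≟_ (orbitList σ i))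

-- multiset (as a list) of cycle lengths of σ: one entry per cycle,
-- the cycle being represented by its least element i (i ≤ every
-- element of its orbit)
cycleLengths : ∀ {n} → Perm n → List ℕ
cycleLengths σ =
  map (cycleLength σ)
      (filter (λ i → all? (λ j → i ≤ᶠ? j) (orbitList σ i)) (allFin _))

HasCycleType : ∀ {n} → Perm n → Partition → Set
HasCycleType σ λ′ = Partition.parts λ′ ↭ cycleLengths σ

-- φ_λ is a finite disjunction over all maps f : Fin m → Fin m, m ≤ |λ|, one
-- disjunct per f; its first conjunct is the constant ⊤ or ⊥ according as the
-- cycle type of f (computed outside the logic) is λ.  The second conjunct says
-- that m points, listed in position order, exhaust the domain and carry the
-- value pattern f.  This forces the permutation to have size m and to equal f,
-- since a strictly increasing self-map of Fin n is the identity.  Conversely a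
-- permutation of cycle type λ has size at most |λ|, the sum of its cycle
-- lengths, because its cycles cover the domain; so its own disjunct occurs.
module Submission where

open import Defs
open import Data.Empty using (⊥-elim)
open import Data.Fin as Fin
  using (Fin; zero; suc; toℕ; fromℕ<; inject₁; _↑ˡ_; opposite; _<_; _≤_; _<?_)
open import Data.Fin.Permutation using (_⟨$⟩ʳ_; _⟨$⟩ˡ_; inverseˡ; inverseʳ)
import Data.Fin.Properties as Finₚ
open import Data.List
  using (List; []; _∷_; _++_; map; filter; length; concat; deduplicate; upTo; allFin)
import Data.List.Extrema
open import Data.List.Membership.Propositional using (_∈_)
import Data.List.Membership.Propositional.Properties as ∈ₚ
import Data.List.Membership.Setoid.Properties as ∈ₛ
import Data.List.Properties as Listₚ
open import Data.List.Relation.Binary.Permutation.Propositional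
  using (_↭_; ↭-refl; ↭-prep; ↭-trans; ↭-sym)
import Data.List.Relation.Binary.Permutation.Propositional.Properties as ↭ₚ
open import Data.List.Relation.Unary.All as All using (All)
open import Data.List.Relation.Unary.Any as Any using (here)
open import Data.Nat as ℕ using (ℕ; zero; suc; _+_; _*_; _∸_; z≤n; s≤s; NonZero)
open import Data.Nat.DivMod using (_%_; _/_; m≡m%n+[m/n]*n; m%n<n)
open import Data.Nat.GeneralisedArithmetic using (fold)
open import Data.Nat.ListAction using (sum)
open import Data.Nat.ListAction.Properties using (sum-↭)
import Data.Nat.Properties as ℕₚ
open import Data.Product using (Σ; ∃; _×_; _,_; proj₁; proj₂)
open import Data.Sum using (inj₁; inj₂)
open import Data.Unit using (tt)
import Data.Vec.Functional as Vector
open import Function using (_∘_; id)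
open import Function.Bundles using (_⇔_; mk⇔)
open import Relation.Binary using (DecidableEquality; tri<; tri≈; tri>)
open import Relation.Binary.Core using (_Preserves_⟶_)
open import Relation.Binary.PropositionalEquality
open import Relation.Nullary using (¬_; Dec; yes; no)

module DecPermutation {a} {A : Set a} (_≟_ : DecidableEquality A) where
  open import Data.List.Membership.DecPropositional _≟_ using (_∈?_)

  infix 4 _↭?_
  _↭?_ : (xs ys : List A) → Dec (xs ↭ ys)
  []       ↭? []      = yes ↭-refl
  []       ↭? (_ ∷ _) = no λ p → ℕₚ.0≢1+n (↭ₚ.↭-length p)
  (x ∷ xs) ↭? ys with x ∈? ys
  ... | no x∉ys = no λ p → x∉ys (↭ₚ.∈-resp-↭ p (here refl))
  ... | yes x∈ys with ∈ₚ.∈-∃++ x∈ys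
  ...   | us , vs , refl with xs ↭? (us ++ vs)
  ...     | yes p = yes (↭-trans (↭-prep x p) (↭-sym (↭ₚ.shift x us vs)))
  ...     | no ¬p = no (¬p ∘ ↭ₚ.drop-mid [] us)

<-preserving⇒injective : ∀ {m n} {h : Fin m → Fin n} → h Preserves _<_ ⟶ _<_ →
                         ∀ {i j} → h i ≡ h j → i ≡ j
<-preserving⇒injective h-< {i} {j} hi≡hj with Finₚ.<-cmp i j
... | tri< i<j _ _ = ⊥-elim (Finₚ.<⇒≢ (h-< i<j) hi≡hj)
... | tri≈ _ i≡j _ = i≡j
... | tri> _ _ j<i = ⊥-elim (Finₚ.<⇒≢ (h-< j<i) (sym hi≡hj))

<-preserving⇒≤ : ∀ {m n} {h : Fin m → Fin n} → h Preserves _<_ ⟶ _<_ → ∀ i → toℕ i ℕ.≤ toℕ (h i)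
<-preserving⇒≤ h-< zero    = z≤n
<-preserving⇒≤ h-< (suc i) =
  ℕₚ.≤-<-trans (<-preserving⇒≤ (h-< ∘ inject₁-mono) i) (h-< (Finₚ.≤̄⇒inject₁< ℕₚ.≤-refl))
  where
  inject₁-mono : ∀ {m} {i j : Fin m} → i < j → inject₁ i < inject₁ j
  inject₁-mono = subst₂ ℕ._<_ (sym (Finₚ.toℕ-inject₁ _)) (sym (Finₚ.toℕ-inject₁ _))

opposite-< : ∀ {n} {i j : Fin n} → i < j → opposite j < opposite i
opposite-< {n} {i} {j} i<j =
  subst₂ ℕ._<_ (sym (Finₚ.opposite-prop j)) (sym (Finₚ.opposite-prop i))
    (ℕₚ.∸-monoʳ-< (s≤s i<j) (Finₚ.toℕ<n j))

-- The upper bound h i ≤ i is the lower bound for the reflected map opposite ∘ h ∘ opposite.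
<-preserving⇒≗id : ∀ {n} {h : Fin n → Fin n} → h Preserves _<_ ⟶ _<_ → ∀ i → h i ≡ i
<-preserving⇒≗id {h = h} h-< i =
  Finₚ.toℕ-injective (ℕₚ.≤-antisym (ℕₚ.≮⇒≥ i≮hi) (<-preserving⇒≤ h-< i))
  where
  i≮hi : ¬ (i < h i)
  i≮hi i<hi = ℕₚ.<⇒≱ (opposite-< i<hi)
    (subst (λ j → toℕ (opposite i) ℕ.≤ toℕ (opposite (h j))) (Finₚ.opposite-involutive i)
      (<-preserving⇒≤ (opposite-< ∘ h-< ∘ opposite-<) (opposite i)))

⌜_⌝ : ∀ {p k} {P : Set p} → Dec P → Formula k
⌜ yes _ ⌝ = ⊤'
⌜ no _ ⌝  = ⊥'

⋀ : ∀ {k} m → (Fin m → Formula k) → Formula k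
⋀ zero    F = ⊤'
⋀ (suc m) F = F zero ∧' ⋀ m (F ∘ suc)

⋁ : ∀ {k} m → (Fin m → Formula k) → Formula k
⋁ zero    F = ⊥'
⋁ (suc m) F = F zero ∨' ⋁ m (F ∘ suc)

⋁maps : ∀ {k} j m → ((Fin j → Fin m) → Formula k) → Formula k
⋁maps zero    m P = P (λ ())
⋁maps (suc j) m P = ⋁ m λ b → ⋁maps j m (λ g → P (b Vector.∷ g))

∃* : ∀ {k} m → Formula (m + k) → Formula k
∃* zero    φ = φ
∃* (suc m) φ = ∃* m (∃' φ)

extend* : ∀ {k n} m → (Fin m → Fin n) → (Fin k → Fin n) → Fin (m + k) → Fin n
extend* zero    a ρ = ρ
extend* (suc m) a ρ = extend (extend* m (Vector.tail a) ρ) (Vector.head a)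

extend*-↑ˡ : ∀ {k n} m (a : Fin m → Fin n) (ρ : Fin k → Fin n) i →
                  extend* m a ρ (i ↑ˡ k) ≡ a i
extend*-↑ˡ (suc m) a ρ zero    = refl
extend*-↑ˡ (suc m) a ρ (suc i) = extend*-↑ˡ m (Vector.tail a) ρ i

module _ {n} (σ : Perm n) {k} {ρ : Fin k → Fin n} where

  sat-⌜⌝⁻ : ∀ {p} {P : Set p} (d : Dec P) → Sat σ ⌜ d ⌝ ρ → P
  sat-⌜⌝⁻ (yes p) _ = p

  sat-⌜⌝⁺ : ∀ {p} {P : Set p} (d : Dec P) → P → Sat σ ⌜ d ⌝ ρ
  sat-⌜⌝⁺ (yes _) _ = tt
  sat-⌜⌝⁺ (no ¬p) p = ¬p p

  sat-⋀⁻ : ∀ m (F : Fin m → Formula k) → Sat σ (⋀ m F) ρ → ∀ i → Sat σ (F i) ρ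
  sat-⋀⁻ (suc m) F (s , _) zero    = s
  sat-⋀⁻ (suc m) F (_ , s) (suc i) = sat-⋀⁻ m (F ∘ suc) s i

  sat-⋀⁺ : ∀ m (F : Fin m → Formula k) → (∀ i → Sat σ (F i) ρ) → Sat σ (⋀ m F) ρ
  sat-⋀⁺ zero    F s = tt
  sat-⋀⁺ (suc m) F s = s zero , sat-⋀⁺ m (F ∘ suc) (s ∘ suc)

  sat-⋁⁻ : ∀ m (F : Fin m → Formula k) → Sat σ (⋁ m F) ρ → ∃ λ i → Sat σ (F i) ρ
  sat-⋁⁻ (suc m) F (inj₁ s) = zero , s
  sat-⋁⁻ (suc m) F (inj₂ s) with i , s′ ← sat-⋁⁻ m (F ∘ suc) s = suc i , s′

  sat-⋁⁺ : ∀ m (F : Fin m → Formula k) i → Sat σ (F i) ρ → Sat σ (⋁ m F) ρ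
  sat-⋁⁺ (suc m) F zero    s = inj₁ s
  sat-⋁⁺ (suc m) F (suc i) s = inj₂ (sat-⋁⁺ m (F ∘ suc) i s)

  sat-⋁maps⁻ : ∀ j m (P : (Fin j → Fin m) → Formula k) →
               Sat σ (⋁maps j m P) ρ → ∃ λ g → Sat σ (P g) ρ
  sat-⋁maps⁻ zero    m P s = (λ ()) , s
  sat-⋁maps⁻ (suc j) m P s
    with b , s′ ← sat-⋁⁻ m _ s
    with g , s″ ← sat-⋁maps⁻ j m (λ g → P (b Vector.∷ g)) s′ = b Vector.∷ g , s″

  sat-⋁maps⁺ : ∀ j m (P : (Fin j → Fin m) → Formula k) (g : Fin j → Fin m) →
               (∀ g′ → (∀ i → g′ i ≡ g i) → Sat σ (P g′) ρ) → Sat σ (⋁maps j m P) ρ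
  sat-⋁maps⁺ zero    m P g s = s (λ ()) (λ ())
  sat-⋁maps⁺ (suc j) m P g s =
    sat-⋁⁺ m _ (g zero) (sat-⋁maps⁺ j m _ (g ∘ suc) λ g′ g′≗ →
      s (g zero Vector.∷ g′) λ { zero → refl ; (suc i) → g′≗ i })

module _ {n} (σ : Perm n) where

  sat-∃*⁻ : ∀ {k} m (φ : Formula (m + k)) {ρ : Fin k → Fin n} →
            Sat σ (∃* m φ) ρ → ∃ λ a → Sat σ φ (extend* m a ρ)
  sat-∃*⁻ zero    φ s = (λ ()) , s
  sat-∃*⁻ (suc m) φ s with a , b , s′ ← sat-∃*⁻ m (∃' φ) s = b Vector.∷ a , s′

  sat-∃*⁺ : ∀ {k} m (φ : Formula (m + k)) {ρ : Fin k → Fin n} a →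
            Sat σ φ (extend* m a ρ) → Sat σ (∃* m φ) ρ
  sat-∃*⁺ zero    φ a s = s
  sat-∃*⁺ (suc m) φ a s = sat-∃*⁺ m (∃' φ) (Vector.tail a) (Vector.head a , s)

record Enumerates {m n} (σ : Perm n) (f : Fin m → Fin m) (a : Fin m → Fin n) : Set where
  field
    increasing      : a Preserves _<_ ⟶ _<_
    surjective      : ∀ y → ∃ λ i → a i ≡ y
    reflects-values : ∀ {i j} → σ ⟨$⟩ʳ a i < σ ⟨$⟩ʳ a j → f i < f j

module _ {m} (f : Fin m → Fin m) where

  -- Variable x i stands for the i-th point of the permutation in position order.
  private
    x : Fin m → Fin (m + 0)
    x i = i ↑ˡ 0

  diagram : Formula (m + 0)
  diagram =
    ⋀ m (λ i → ⋀ m λ j → (⌜ i <? j ⌝ ⇒' (x i <P x j)) ∧' ((x i <V x j) ⇒' ⌜ f i <? f j ⌝))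
    ∧' ∀' (⋁ m λ i → zero ≐ suc (x i))

  diagramSentence : Sentence
  diagramSentence = ∃* m diagram

  module _ {n} (σ : Perm n) (a : Fin m → Fin n) where
    private
      ρ : Fin (m + 0) → Fin n
      ρ = extend* m a (λ ())
      ρ-x : ∀ i → ρ (x i) ≡ a i
      ρ-x = extend*-↑ˡ m a (λ ())

    sat-diagram⁻ : Sat σ diagram ρ → Enumerates σ f a
    sat-diagram⁻ (atoms , cover) = record
      { increasing      = λ {i} {j} i<j →
          subst₂ _<_ (ρ-x i) (ρ-x j) (proj₁ (atom i j) (sat-⌜⌝⁺ σ (i <? j) i<j))
      ; surjective      = λ y → let i , y≡ρxi = sat-⋁⁻ σ m _ (cover y) in i , sym (trans y≡ρxi (ρ-x i))
      ; reflects-values = λ {i} {j} σai<σaj → sat-⌜⌝⁻ σ (f i <? f j)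
          (proj₂ (atom i j) (subst₂ (λ u v → σ ⟨$⟩ʳ u < σ ⟨$⟩ʳ v) (sym (ρ-x i)) (sym (ρ-x j)) σai<σaj))
      }
      where
      atom : ∀ i j → Sat σ ((⌜ i <? j ⌝ ⇒' (x i <P x j)) ∧' ((x i <V x j) ⇒' ⌜ f i <? f j ⌝)) ρ
      atom i j = sat-⋀⁻ σ m _ (sat-⋀⁻ σ m _ atoms i) j

    sat-diagram⁺ : Enumerates σ f a → Sat σ diagram ρ
    sat-diagram⁺ E = sat-⋀⁺ σ m _ (λ i → sat-⋀⁺ σ m _ λ j → position i j , value i j) , cover
      where
      open Enumerates E
      position : ∀ i j → Sat σ ⌜ i <? j ⌝ ρ → ρ (x i) < ρ (x j)
      position i j s = subst₂ _<_ (sym (ρ-x i)) (sym (ρ-x j)) (increasing (sat-⌜⌝⁻ σ (i <? j) s))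
      value : ∀ i j → σ ⟨$⟩ʳ ρ (x i) < σ ⟨$⟩ʳ ρ (x j) → Sat σ ⌜ f i <? f j ⌝ ρ
      value i j σρ< = sat-⌜⌝⁺ σ (f i <? f j)
        (reflects-values (subst₂ (λ u v → σ ⟨$⟩ʳ u < σ ⟨$⟩ʳ v) (ρ-x i) (ρ-x j) σρ<))
      cover : ∀ y → Sat σ (⋁ m λ i → zero ≐ suc (x i)) (extend ρ y)
      cover y = let i , ai≡y = surjective y in sat-⋁⁺ σ m _ i (sym (trans (ρ-x i) ai≡y))

module _ {m n} {σ : Perm n} {f : Fin m → Fin m} where

  ⊨diagram⁻ : σ ⊨ diagramSentence f → ∃ (Enumerates σ f)
  ⊨diagram⁻ s with a , s′ ← sat-∃*⁻ σ m (diagram f) s = a , sat-diagram⁻ f σ a s′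

  ⊨diagram⁺ : ∀ {a} → Enumerates σ f a → σ ⊨ diagramSentence f
  ⊨diagram⁺ {a} E = sat-∃*⁺ σ m (diagram f) a (sat-diagram⁺ f σ a E)

  enumerates⇒≡ : ∀ {a} → Enumerates σ f a → m ≡ n
  enumerates⇒≡ {a} E = ℕₚ.≤-antisym
    (Finₚ.injective⇒≤ (<-preserving⇒injective increasing))
    (Finₚ.injective⇒≤ {f = proj₁ ∘ surjective} λ {y} {z} i≡j →
      trans (sym (proj₂ (surjective y))) (trans (cong a i≡j) (proj₂ (surjective z))))
    where open Enumerates E

-- a is the identity, so f ∘ σ⁻¹ preserves < and is the identity as well.
enumerates⇒≗ : ∀ {n} {σ : Perm n} {f a} → Enumerates σ f a → ∀ i → f i ≡ σ ⟨$⟩ʳ i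
enumerates⇒≗ {σ = σ} {f} E i = trans (cong f (sym (inverseˡ σ))) (<-preserving⇒≗id f∘σ⁻¹-< (σ ⟨$⟩ʳ i))
  where
  open Enumerates E
  f∘σ⁻¹-< : (f ∘ (σ ⟨$⟩ˡ_)) Preserves _<_ ⟶ _<_
  f∘σ⁻¹-< v<w = reflects-values
    (subst₂ (λ u w → σ ⟨$⟩ʳ u < σ ⟨$⟩ʳ w)
      (sym (<-preserving⇒≗id increasing _)) (sym (<-preserving⇒≗id increasing _))
      (subst₂ _<_ (sym (inverseʳ σ)) (sym (inverseʳ σ)) v<w))

enumerates-id : ∀ {n} {σ : Perm n} {f} → (∀ i → f i ≡ σ ⟨$⟩ʳ i) → Enumerates σ f id
enumerates-id f≗σ = record
  { increasing      = id
  ; surjective      = λ y → y , refl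
  ; reflects-values = subst₂ _<_ (sym (f≗σ _)) (sym (f≗σ _))
  }

-- cycleLengths σ is cycleLengthsBy (iter σ) by definition; the generalisation
-- lets a sentence mention the cycle type of an arbitrary candidate map.
cycleLengthsBy : ∀ {n} → (ℕ → Fin n → Fin n) → List ℕ
cycleLengthsBy {n} I =
  map (λ i → length (deduplicate Finₚ._≟_ (orbit i)))
      (filter (λ i → All.all? (λ j → i Fin.≤? j) (orbit i)) (allFin n))
  where
  orbit : Fin n → List (Fin n)
  orbit i = map (λ k → I k i) (upTo n)

cycleLengthsBy-cong : ∀ {n} {I J : ℕ → Fin n → Fin n} → (∀ k i → I k i ≡ J k i) →
                      cycleLengthsBy I ≡ cycleLengthsBy J
cycleLengthsBy-cong {n} {I} {J} I≗J =
  trans (Listₚ.map-cong (λ i → cong (length ∘ deduplicate Finₚ._≟_) (orbit-≡ i)) _)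
        (cong (map _) (Listₚ.filter-≐ _ _
          ((λ {i} → subst (All _) (orbit-≡ i)) , (λ {i} → subst (All _) (sym (orbit-≡ i))))
          (allFin n)))
  where
  orbit-≡ : ∀ i → map (λ k → I k i) (upTo n) ≡ map (λ k → J k i) (upTo n)
  orbit-≡ i = Listₚ.map-cong (λ k → I≗J k i) (upTo n)

cycleLengthsOf : ∀ {n} → (Fin n → Fin n) → List ℕ
cycleLengthsOf g = cycleLengthsBy λ k i → fold i g k

cycleLengthsOf-≗ : ∀ {n} (σ : Perm n) {g : Fin n → Fin n} → (∀ i → g i ≡ σ ⟨$⟩ʳ i) →
                   cycleLengthsOf g ≡ cycleLengths σ
cycleLengthsOf-≗ σ {g} g≗σ = cycleLengthsBy-cong fold≗iter
  where
  fold≗iter : ∀ k i → fold i g k ≡ iter σ k i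
  fold≗iter zero    i = refl
  fold≗iter (suc k) i = trans (g≗σ _) (cong (σ ⟨$⟩ʳ_) (fold≗iter k i))

length-concat : ∀ {a} {A : Set a} (xss : List (List A)) → length (concat xss) ≡ sum (map length xss)
length-concat []         = refl
length-concat (xs ∷ xss) = trans (Listₚ.length-++ xs) (cong (length xs +_) (length-concat xss))

cover⇒≤length : ∀ {n} {xs : List (Fin n)} → (∀ j → j ∈ xs) → n ℕ.≤ length xs
cover⇒≤length c = Finₚ.injective⇒≤ {f = Any.index ∘ c} (∈ₛ.index-injective (setoid _) (c _) (c _))

module Orbits {n} (σ : Perm n) where
  open ≡-Reasoning
  open Data.List.Extrema (Finₚ.≤-totalOrder n) using (min; argmin-all; min≤xs)

  iter-+ : ∀ k l i → iter σ (k + l) i ≡ iter σ k (iter σ l i)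
  iter-+ zero    l i = refl
  iter-+ (suc k) l i = cong (σ ⟨$⟩ʳ_) (iter-+ k l i)

  iter-injective : ∀ k {x y} → iter σ k x ≡ iter σ k y → x ≡ y
  iter-injective zero    e = e
  iter-injective (suc k) e = iter-injective k (trans (sym (inverseˡ σ)) (trans (cong (σ ⟨$⟩ˡ_) e) (inverseˡ σ)))

  -- By pigeonhole two of iter σ 0 i, …, iter σ n i coincide; cancel the smaller exponent.
  period : ∀ i → ∃ λ p → 0 ℕ.< p × p ℕ.≤ n × iter σ p i ≡ i
  period i
    with k , l , k<l , iₖ≡iₗ ← Finₚ.pigeonhole (ℕₚ.n<1+n n) (λ (k : Fin (suc n)) → iter σ (toℕ k) i) =
    toℕ l ∸ toℕ k , ℕₚ.m<n⇒0<n∸m k<l ,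
    ℕₚ.≤-trans (ℕₚ.m∸n≤m (toℕ l) (toℕ k)) (ℕ.s≤s⁻¹ (Finₚ.toℕ<n l)) , iter-injective (toℕ k) cancelled
    where
    cancelled : iter σ (toℕ k) (iter σ (toℕ l ∸ toℕ k) i) ≡ iter σ (toℕ k) i
    cancelled = begin
      iter σ (toℕ k) (iter σ (toℕ l ∸ toℕ k) i) ≡⟨ iter-+ (toℕ k) _ i ⟨
      iter σ (toℕ k + (toℕ l ∸ toℕ k)) i        ≡⟨ cong (λ e → iter σ e i) (ℕₚ.m+[n∸m]≡n (ℕₚ.<⇒≤ k<l)) ⟩
      iter σ (toℕ l) i                          ≡⟨ iₖ≡iₗ ⟨
      iter σ (toℕ k) i                          ∎

  iter-* : ∀ {p i} → iter σ p i ≡ i → ∀ c → iter σ (c * p) i ≡ i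
  iter-*             pᵢ zero    = refl
  iter-* {p} {i} pᵢ (suc c) = trans (iter-+ p (c * p) i) (trans (cong (iter σ p) (iter-* pᵢ c)) pᵢ)

  iter-% : ∀ {p i} .{{_ : NonZero p}} → iter σ p i ≡ i → ∀ k → iter σ (k % p) i ≡ iter σ k i
  iter-% {p} {i} pᵢ k = begin
    iter σ (k % p) i                      ≡⟨ cong (iter σ (k % p)) (iter-* pᵢ (k / p)) ⟨
    iter σ (k % p) (iter σ (k / p * p) i) ≡⟨ iter-+ (k % p) (k / p * p) i ⟨
    iter σ (k % p + k / p * p) i          ≡⟨ cong (λ e → iter σ e i) (m≡m%n+[m/n]*n k p) ⟨
    iter σ k i                            ∎

  infix 4 _↝_
  _↝_ : Fin n → Fin n → Set
  i ↝ x = ∃ λ k → iter σ k i ≡ x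

  ∈orbit⇒↝ : ∀ {i x} → x ∈ orbitList σ i → i ↝ x
  ∈orbit⇒↝ x∈ with k , _ , x≡ ← ∈ₚ.∈-map⁻ _ x∈ = k , sym x≡

  ↝⇒∈orbit : ∀ {i x} → i ↝ x → x ∈ orbitList σ i
  ↝⇒∈orbit {i} (k , refl) with p , 0<p , p≤n , pᵢ ← period i =
    subst (_∈ orbitList σ i) (iter-% {{ℕ.>-nonZero 0<p}} pᵢ k)
      (∈ₚ.∈-map⁺ (λ k → iter σ k i)
        (∈ₚ.∈-upTo⁺ (ℕₚ.<-≤-trans (m%n<n k p {{ℕ.>-nonZero 0<p}}) p≤n)))

  ↝-trans : ∀ {i x y} → i ↝ x → x ↝ y → i ↝ y
  ↝-trans {i} (k , refl) (l , refl) = l + k , iter-+ l k i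

  ↝-sym : ∀ {i x} → i ↝ x → x ↝ i
  ↝-sym {i} (k , refl) with p , 0<p , _ , pᵢ ← period i =
    k * p ∸ k , (begin
      iter σ (k * p ∸ k) (iter σ k i) ≡⟨ iter-+ (k * p ∸ k) k i ⟨
      iter σ (k * p ∸ k + k) i        ≡⟨ cong (λ e → iter σ e i) (ℕₚ.m∸n+n≡m (ℕₚ.m≤m*n k p {{ℕ.>-nonZero 0<p}})) ⟩
      iter σ (k * p) i                ≡⟨ iter-* pᵢ k ⟩
      i                               ∎)

  representatives : List (Fin n)
  representatives = filter (λ i → All.all? (λ j → i Fin.≤? j) (orbitList σ i)) (allFin n)

  ∈orbit-representative : ∀ j → ∃ λ r → r ∈ representatives × j ∈ orbitList σ r
  ∈orbit-representative j =
    r , ∈ₚ.∈-filter⁺ _ (∈ₚ.∈-allFin r) (All.tabulate r≤orbit) , ↝⇒∈orbit (↝-sym j↝r)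
    where
    r : Fin n
    r = min j (orbitList σ j)
    j↝r : j ↝ r
    j↝r = argmin-all id (0 , refl) (All.tabulate ∈orbit⇒↝)
    r≤orbit : ∀ {y} → y ∈ orbitList σ r → r ≤ y
    r≤orbit y∈ = All.lookup (min≤xs j (orbitList σ j)) (↝⇒∈orbit (↝-trans j↝r (∈orbit⇒↝ y∈)))

  n≤sum-cycleLengths : n ℕ.≤ sum (cycleLengths σ)
  n≤sum-cycleLengths = subst (n ℕ.≤_) length≡sum (cover⇒≤length covered)
    where
    cycle : Fin n → List (Fin n)
    cycle r = deduplicate Finₚ._≟_ (orbitList σ r)
    covered : ∀ j → j ∈ concat (map cycle representatives)
    covered j with r , r∈ , j∈ ← ∈orbit-representative j =
      ∈ₚ.∈-concat⁺′ (∈ₚ.∈-deduplicate⁺ Finₚ._≟_ j∈) (∈ₚ.∈-map⁺ cycle r∈)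
    length≡sum : length (concat (map cycle representatives)) ≡ sum (cycleLengths σ)
    length≡sum = trans (length-concat (map cycle representatives)) (cong sum (sym (Listₚ.map-∘ representatives)))

module _ (λ′ : Partition) where
  open Partition λ′ using (parts)
  open DecPermutation ℕₚ._≟_ using (_↭?_)

  candidate : ∀ {m} → (Fin m → Fin m) → Sentence
  candidate f = ⌜ parts ↭? cycleLengthsOf f ⌝ ∧' diagramSentence f

  ⊨candidate⇒cycleType : ∀ {m n} {σ : Perm n} (f : Fin m → Fin m) → σ ⊨ candidate f →
                         HasCycleType σ λ′
  ⊨candidate⇒cycleType {σ = σ} f (parts↭f , σ⊨diagram)
    with a , E ← ⊨diagram⁻ {f = f} σ⊨diagram
    with refl ← enumerates⇒≡ E =
    subst (parts ↭_) (cycleLengthsOf-≗ σ (enumerates⇒≗ E))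
      (sat-⌜⌝⁻ σ (parts ↭? cycleLengthsOf f) parts↭f)

  cycleType⇒⊨candidate : ∀ {n} {σ : Perm n} {f : Fin n → Fin n} → (∀ i → f i ≡ σ ⟨$⟩ʳ i) →
                         HasCycleType σ λ′ → σ ⊨ candidate f
  cycleType⇒⊨candidate {σ = σ} {f} f≗σ parts↭σ =
    sat-⌜⌝⁺ σ (parts ↭? cycleLengthsOf f) (subst (parts ↭_) (sym (cycleLengthsOf-≗ σ f≗σ)) parts↭σ)
    , ⊨diagram⁺ (enumerates-id f≗σ)

  -- Sizes beyond the sum of the parts need no disjunct, by n≤sum-cycleLengths.
  cycleTypeSentence : Sentence
  cycleTypeSentence = ⋁ (suc (sum parts)) λ m → ⋁maps (toℕ m) (toℕ m) candidate

  ⊨cycleTypeSentence⇒cycleType : ∀ {n} (σ : Perm n) → σ ⊨ cycleTypeSentence → HasCycleType σ λ′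
  ⊨cycleTypeSentence⇒cycleType σ s
    with m , s′ ← sat-⋁⁻ σ (suc (sum parts)) _ s
    with f , s″ ← sat-⋁maps⁻ σ (toℕ m) (toℕ m) candidate s′ = ⊨candidate⇒cycleType f s″

  cycleType⇒⊨cycleTypeSentence : ∀ {n} (σ : Perm n) → HasCycleType σ λ′ → σ ⊨ cycleTypeSentence
  cycleType⇒⊨cycleTypeSentence {n} σ parts↭σ =
    sat-⋁⁺ σ (suc (sum parts)) (λ m → ⋁maps (toℕ m) (toℕ m) candidate) (fromℕ< (s≤s n≤sum))
      (subst (λ k → σ ⊨ ⋁maps k k candidate) (sym (Finₚ.toℕ-fromℕ< (s≤s n≤sum)))
        (sat-⋁maps⁺ σ {ρ = λ ()} n n candidate (σ ⟨$⟩ʳ_) λ _ f≗σ → cycleType⇒⊨candidate f≗σ parts↭σ))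
    where
    n≤sum : n ℕ.≤ sum parts
    n≤sum = subst (n ℕ.≤_) (sym (sum-↭ parts↭σ)) (Orbits.n≤sum-cycleLengths σ)

proposition3p18 : (λ′ : Partition) →
    Σ Sentence (λ φ → (n : ℕ) (σ : Perm n) → (σ ⊨ φ) ⇔ HasCycleType σ λ′)
proposition3p18 λ′ =
  cycleTypeSentence λ′ ,
  λ n σ → mk⇔ (⊨cycleTypeSentence⇒cycleType λ′ σ) (cycleType⇒⊨cycleTypeSentence λ′ σ)
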